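{- Let $1\le p_1\le\cdots\le p_d\le n$ be integers, and let $G_0=G_0(p_1,\ldots,p_d)$ be the $d$-uniform $d$-partite hypergraph with vertex classes $V_1,\ldots,V_d$, each consisting of $n$ vertices labeled $1,\ldots,n$, in which an edge is identified with a tuple $(x_1,\ldots,x_d)\in[n]^d$ (taking from $V_i$ the vertex labeled $x_i$), and in which $(x_1,\ldots,x_d)$ is NOT an edge of $G_0$ if and only if $x_{(i)}\ge p_i$ for every $1\le i\le d$. Then $W_n(p_1,\ldots,p_d)\le \|G_0\|$, where $\|G_0\|$ denotes the number of edges of $G_0$.
   Context: $x_{(i)}$ denotes the $i$-th smallest entry of $x$ when its entries are sorted with repetitions. A $d$-uniform $d$-partite hypergraph has vertex classes $V_1,\ldots,V_d$ and edges that contain exactly one vertex from each class; only such crossing $d$-sets are considered as potential edges. $K^d_{p_1,\ldots,p_d}$ is the complete $d$-uniform $d$-partite hypergraph with classes of sizes $p_1,\ldots,p_d$; a copy of it is given by sets $S_i\subseteq V_i$ with $|S_i|=p_{\pi(i)}$ for some permutation $\pi$ of $[d]$ such that all crossing $d$-sets within $\bigcup S_i$ are edges. A hypergraph is weakly $K^d_{p_1,\ldots,p_d}$-saturated if its non-edges can be added one at a time in some order so that each added edge creates a new copy of $K^d_{p_1,\ldots,p_d}$ (containing that edge). $W_n(p_1,\ldots,p_d)$ is the minimum number of edges of a weakly $K^d_{p_1,\ldots,p_d}$-saturated $d$-uniform $d$-partite hypergraph with $n$ vertices in each class. -}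

module Defs where

open import Data.Nat using (ℕ; zero; suc; _≤_; _≤ᵇ_; _≤?_)
open import Data.Bool using (Bool; true; false; not; if_then_else_)
open import Data.Fin using (Fin; toℕ) renaming (_≤_ to _≤ᶠ_)
open import Data.Fin.Properties using (all?)
open import Data.Fin.Subset using (Subset; _∈_; ∣_∣)
open import Data.Fin.Permutation using (Permutation′; _⟨$⟩ʳ_)
open import Data.Vec using (Vec; []; _∷_; lookup; map)
open import Data.List using (List; concatMap; allFin; length; filterᵇ) renaming ([] to []ₗ; _∷_ to _∷ₗ_; map to mapₗ)
open import Data.List.Membership.Propositional using () renaming (_∈_ to _∈ₗ_)
open import Data.Product using (Σ; ∃; _×_; _,_)
open import Data.Sum using (_⊎_)
open import Data.Unit using (⊤)
open import Relation.Nullary using (¬_; does)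
open import Relation.Binary.PropositionalEquality using (_≡_)

insert : {m : ℕ} → ℕ → Vec ℕ m → Vec ℕ (suc m)
insert a [] = a ∷ []
insert a (b ∷ bs) = if a ≤ᵇ b then a ∷ b ∷ bs else b ∷ insert a bs

sortVec : {m : ℕ} → Vec ℕ m → Vec ℕ m
sortVec [] = []
sortVec (a ∷ as) = insert a (sortVec as)

-- A tuple (x_1,...,x_d) ∈ [n]^d; vertex with label k is represented by Fin n element k-1.
Tuple : ℕ → ℕ → Set
Tuple d n = Vec (Fin n) d

labels : {d n : ℕ} → Tuple d n → Vec ℕ d
labels x = map (λ v → suc (toℕ v)) x

-- x_(i+1) : the (i+1)-th smallest label (i : Fin d is 0-indexed)
orderStat : {d n : ℕ} → Tuple d n → Fin d → ℕ
orderStat x i = lookup (sortVec (labels x)) i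

-- d-uniform d-partite hypergraph with n vertices per class, given by its edge set
-- (a crossing d-set is identified with the tuple of labels of its vertices).
Hypergraph : ℕ → ℕ → Set
Hypergraph d n = Tuple d n → Bool

allTuples : (d n : ℕ) → List (Tuple d n)
allTuples zero n = [] ∷ₗ []ₗ
allTuples (suc d) n = concatMap (λ i → mapₗ (i ∷_) (allTuples d n)) (allFin n)

edgeCount : {d n : ℕ} → Hypergraph d n → ℕ
edgeCount {d} {n} H = length (filterᵇ H (allTuples d n))

G0 : {d : ℕ} (n : ℕ) → (Fin d → ℕ) → Hypergraph d n
G0 n p x = not (does (all? (λ i → p i ≤? orderStat x i)))

-- Intermediate graphs during the saturation process, as predicates on tuples.
EdgePred : ℕ → ℕ → Set₁
EdgePred d n = Tuple d n → Set

addEdge : {d n : ℕ} → EdgePred d n → Tuple d n → EdgePred d n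
addEdge G e x = G x ⊎ x ≡ e

-- G contains a copy of K^d_{p_1..p_d} containing the edge e:
-- sets S_i ⊆ V_i with |S_i| = p_{π(i)} for a permutation π, e has its i-th vertex in S_i,
-- and every crossing tuple inside the S_i's is an edge of G.
CopyContaining : {d n : ℕ} → (Fin d → ℕ) → EdgePred d n → Tuple d n → Set
CopyContaining {d} {n} p G e =
  Σ (Permutation′ d) λ π → Σ (Fin d → Subset n) λ S →
    (∀ i → ∣ S i ∣ ≡ p (π ⟨$⟩ʳ i)) ×
    (∀ i → lookup e i ∈ S i) ×
    (∀ (x : Tuple d n) → (∀ i → lookup x i ∈ S i) → G x)

ValidSequence : {d n : ℕ} → (Fin d → ℕ) → EdgePred d n → List (Tuple d n) → Set
ValidSequence p G []ₗ = ⊤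
ValidSequence p G (e ∷ₗ es) =
  (¬ G e) × CopyContaining p (addEdge G e) e × ValidSequence p (addEdge G e) es

asPred : {d n : ℕ} → Hypergraph d n → EdgePred d n
asPred H x = H x ≡ true

WeaklySaturated : {d n : ℕ} → (Fin d → ℕ) → Hypergraph d n → Set
WeaklySaturated {d} {n} p H =
  Σ (List (Tuple d n)) λ L →
    ValidSequence p (asPred H) L × (∀ x → H x ≡ false → x ∈ₗ L)

-- W_n(p_1,...,p_d) ≤ m  (unfolding of "the minimum is at most m")
W≤ : (d n : ℕ) → (Fin d → ℕ) → ℕ → Set
W≤ d n p m = Σ (Hypergraph d n) λ H → WeaklySaturated p H × edgeCount H ≤ m

-- G₀ itself is weakly saturated: add its non-edges in lexicographic order. If x is a
-- non-edge and τ sorts its labels, then x_j = x_(τ j) ≥ p_(τ j), so S_j = {the p_(τ j) − 1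
-- smallest vertices of V_j} ∪ {x_j} spans a copy of K (class sizes permuted by τ) through x.
-- Every other tuple of that copy lies coordinatewise, hence lexicographically, below x, so
-- it is an edge of G₀ or a non-edge added earlier.
module Submission where

open import Defs
open import Data.Nat using (ℕ; zero; suc; pred; _≤_; _≤?_; _≤ᵇ_; z≤n; s≤s; >-nonZero)
open import Data.Nat.Properties using (<⇒≱; suc-pred; pred-mono-≤; ≤-refl)
open import Data.Bool using (true; false; not)
open import Data.Fin using (Fin; zero; suc; toℕ; _<_) renaming (_≤_ to _≤ᶠ_)
open import Data.Fin.Properties as Fin using (all?; ≤-reflexive)
open import Data.Fin.Subset using (Subset; inside; ⁅_⁆; ∣_∣) renaming (_∈_ to _∈ˢ_)
open import Data.Fin.Subset.Properties using (∣⁅x⁆∣≡1; x∈⁅x⁆; x∈⁅y⁆⇒x≡y)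
open import Data.Fin.Permutation using (Permutation′; _⟨$⟩ʳ_; id; _∘ₚ_; lift₀; transpose)
open import Data.Vec using (Vec; []; _∷_; lookup; here; there)
open import Data.Vec.Properties using (lookup-map; ≡-dec)
open import Data.Vec.Relation.Binary.Lex.Strict using (Lex-<; <-asym)
open import Data.Vec.Relation.Binary.Lex.Core using (this; next)
open import Data.List using (List; map; allFin; filterᵇ) renaming (_∷_ to _∷ₗ_)
open import Data.List.Membership.Propositional using () renaming (_∈_ to _∈ₗ_)
open import Data.List.Membership.Propositional.Properties
  using (∈-allFin; ∈-map⁺; ∈-concatMap⁺; ∈-filter⁺; ∈-filter⁻)
open import Data.List.Relation.Unary.All as All using (All; []; _∷_)
import Data.List.Relation.Unary.All.Properties as All
open import Data.List.Relation.Unary.Any as Any using (here; there)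
open import Data.List.Relation.Unary.AllPairs as AllPairs using (AllPairs; []; _∷_)
import Data.List.Relation.Unary.AllPairs.Properties as AllPairs
open import Data.Product using (∃; _×_; _,_; proj₂)
open import Data.Sum using (_⊎_; inj₁; inj₂)
open import Data.Unit using (tt)
open import Data.Empty using (⊥-elim)
open import Relation.Nullary using (¬_; yes; no; does; Dec)
open import Relation.Nullary.Decidable using (T?)
open import Relation.Binary.Definitions using (tri<; tri≈; tri>)
open import Relation.Binary.PropositionalEquality using (_≡_; _≢_; _≗_; refl; sym; trans; cong; subst)
open import Function using (_∘_; Equivalence)
open import Data.Bool.Properties using (T-not-≡)

insert-reorders : ∀ {m} a (bs : Vec ℕ m) →
  ∃ λ (σ : Permutation′ (suc m)) → lookup (insert a bs) ∘ (σ ⟨$⟩ʳ_) ≗ lookup (a ∷ bs)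
insert-reorders a [] = id , λ { zero → refl }
insert-reorders a (b ∷ bs) with a ≤ᵇ b
... | true = id , λ _ → refl
... | false with insert-reorders a bs
... | σ , insert∘σ = transpose zero (suc zero) ∘ₚ lift₀ σ , λ where
  zero → insert∘σ zero
  (suc zero) → refl
  (suc (suc k)) → insert∘σ (suc k)

sortVec-reorders : ∀ {m} (v : Vec ℕ m) →
  ∃ λ (τ : Permutation′ m) → lookup (sortVec v) ∘ (τ ⟨$⟩ʳ_) ≗ lookup v
sortVec-reorders [] = id , λ ()
sortVec-reorders (a ∷ as) with sortVec-reorders as
... | τ , sort∘τ with insert-reorders a (sortVec as)
... | σ , insert∘σ = lift₀ τ ∘ₚ σ , λ where
  zero → insert∘σ zero
  (suc k) → trans (insert∘σ (suc (τ ⟨$⟩ʳ k))) (sort∘τ k)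

-- The q smallest elements of Fin n together with x (exactly that when q ≤ toℕ x).
segment : ∀ {n} → ℕ → Fin n → Subset n
segment zero x = ⁅ x ⁆
segment (suc q) zero = ⁅ zero ⁆
segment (suc q) (suc x) = inside ∷ segment q x

∣segment∣ : ∀ {n} q (x : Fin n) → q ≤ toℕ x → ∣ segment q x ∣ ≡ suc q
∣segment∣ zero x _ = ∣⁅x⁆∣≡1 x
∣segment∣ (suc q) (suc x) (s≤s q≤x) = cong suc (∣segment∣ q x q≤x)

x∈segment : ∀ {n} q (x : Fin n) → x ∈ˢ segment q x
x∈segment zero x = x∈⁅x⁆ x
x∈segment (suc q) zero = x∈⁅x⁆ zero
x∈segment (suc q) (suc x) = there (x∈segment q x)

∈segment⇒≤ : ∀ {n} q (x : Fin n) {y} → y ∈ˢ segment q x → y ≤ᶠ x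
∈segment⇒≤ zero x y∈ = ≤-reflexive (x∈⁅y⁆⇒x≡y x y∈)
∈segment⇒≤ (suc q) zero y∈ = ≤-reflexive (x∈⁅y⁆⇒x≡y zero y∈)
∈segment⇒≤ (suc q) (suc x) here = z≤n
∈segment⇒≤ (suc q) (suc x) (there y∈) = s≤s (∈segment⇒≤ q x y∈)

module _ {d n : ℕ} where

  _<ₗ_ : Tuple d n → Tuple d n → Set
  _<ₗ_ = Lex-< _≡_ _<_

  <ₗ-asym : ∀ {x y} → x <ₗ y → ¬ y <ₗ x
  <ₗ-asym = <-asym sym Fin.<-resp₂-≡ Fin.<-asym

  _≤ₚ_ : Tuple d n → Tuple d n → Set
  y ≤ₚ x = ∀ i → lookup y i ≤ᶠ lookup x i

≤ₚ∧≢⇒<ₗ : ∀ {d n} {y x : Tuple d n} → y ≤ₚ x → y ≢ x → y <ₗ x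
≤ₚ∧≢⇒<ₗ {y = []} {[]} _ y≢x = ⊥-elim (y≢x refl)
≤ₚ∧≢⇒<ₗ {y = a ∷ ys} {b ∷ xs} y≤x y≢x with Fin.<-cmp a b
... | tri< a<b _ _ = this a<b refl
... | tri≈ _ refl _ = next refl (≤ₚ∧≢⇒<ₗ (y≤x ∘ suc) (y≢x ∘ cong (a ∷_)))
... | tri> _ _ b<a = ⊥-elim (<⇒≱ b<a (y≤x zero))

∈-allTuples : ∀ {d n} (x : Tuple d n) → x ∈ₗ allTuples d n
∈-allTuples [] = here refl
∈-allTuples {suc d} {n} (i ∷ xs) =
  ∈-concatMap⁺ (λ j → map (j ∷_) (allTuples d n))
    (Any.map (λ { refl → ∈-map⁺ (i ∷_) (∈-allTuples xs) }) (∈-allFin i))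

allTuples-sorted : ∀ d n → AllPairs _<ₗ_ (allTuples d n)
allTuples-sorted zero n = [] ∷ []
allTuples-sorted (suc d) n =
  AllPairs.concat⁺ (All.map⁺ (All.universal (λ _ → block-sorted) (allFin n)))
                   (AllPairs.map⁺ (AllPairs.tabulate⁺-< blocks-sorted))
  where
  T : List (Tuple d n)
  T = allTuples d n
  block : Fin n → List (Tuple (suc d) n)
  block k = map (k ∷_) T
  block-sorted : ∀ {k} → AllPairs _<ₗ_ (block k)
  block-sorted = AllPairs.map⁺ (AllPairs.map (next refl) (allTuples-sorted d n))
  blocks-sorted : ∀ {k k′} → k < k′ → All (λ x → All (x <ₗ_) (block k′)) (block k)
  blocks-sorted k<k′ =
    All.map⁺ (All.universal (λ _ → All.map⁺ (All.universal (λ _ → this k<k′ refl) T)) T)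

nonedges : ∀ {d n} → Hypergraph d n → List (Tuple d n)
nonedges {d} {n} H = filterᵇ (not ∘ H) (allTuples d n)

module _ {d n : ℕ} {H : Hypergraph d n} where

  ∈-nonedges⁻ : ∀ {x} → x ∈ₗ nonedges H → H x ≡ false
  ∈-nonedges⁻ x∈ =
    Equivalence.to T-not-≡ (proj₂ (∈-filter⁻ (T? ∘ (not ∘ H)) {xs = allTuples d n} x∈))

  ∈-nonedges⁺ : ∀ {x} → H x ≡ false → x ∈ₗ nonedges H
  ∈-nonedges⁺ {x} Hx≡false =
    ∈-filter⁺ (T? ∘ (not ∘ H)) (∈-allTuples x) (Equivalence.from T-not-≡ Hx≡false)

module _ {d n : ℕ} (p : Fin d → ℕ) where

  ClosesCopy : Tuple d n → Set₁
  ClosesCopy x =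
    ∀ (G : EdgePred d n) → (∀ y → y ≤ₚ x → y ≢ x → G y) → CopyContaining p (addEdge G x) x

  sorted-validSequence : ∀ (G : EdgePred d n) {L} → AllPairs _<ₗ_ L → All ClosesCopy L →
                  All (¬_ ∘ G) L → (∀ y → G y ⊎ y ∈ₗ L) → ValidSequence p G L
  sorted-validSequence G [] [] [] _ = tt
  sorted-validSequence G {e ∷ₗ L} (e<L ∷ L-sorted) (e-closes ∷ L-closes) (e∉G ∷ L∉G) covered =
    e∉G , e-closes G below-e , sorted-validSequence (addEdge G e) L-sorted L-closes L∉G+e covered′
    where
    below-e : ∀ y → y ≤ₚ e → y ≢ e → G y
    below-e y y≤e y≢e with covered y
    ... | inj₁ y∈G = y∈G
    ... | inj₂ (here y≡e) = ⊥-elim (y≢e y≡e)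
    ... | inj₂ (there y∈L) = ⊥-elim (<ₗ-asym (≤ₚ∧≢⇒<ₗ y≤e y≢e) (All.lookup e<L y∈L))

    later∉G+e : ∀ {x} → e <ₗ x × ¬ G x → ¬ addEdge G e x
    later∉G+e (_ , x∉G) (inj₁ x∈G) = x∉G x∈G
    later∉G+e (e<e , _) (inj₂ refl) = <ₗ-asym e<e e<e

    L∉G+e : All (¬_ ∘ addEdge G e) L
    L∉G+e = All.zipWith later∉G+e (e<L , L∉G)

    covered′ : ∀ y → addEdge G e y ⊎ y ∈ₗ L
    covered′ y with covered y
    ... | inj₁ y∈G = inj₁ (inj₁ y∈G)
    ... | inj₂ (here y≡e) = inj₁ (inj₂ y≡e)
    ... | inj₂ (there y∈L) = inj₂ y∈L

  weaklySaturated : (H : Hypergraph d n) →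
                    (∀ {x} → H x ≡ false → ClosesCopy x) → WeaklySaturated p H
  weaklySaturated H closes =
    nonedges H ,
    sorted-validSequence (asPred H) (AllPairs.filter⁺ (T? ∘ (not ∘ H)) (allTuples-sorted d n))
      (All.tabulate (closes ∘ ∈-nonedges⁻)) (All.tabulate (not-edge ∘ ∈-nonedges⁻)) covered ,
    λ _ → ∈-nonedges⁺
    where
    not-edge : ∀ {x} → H x ≡ false → ¬ asPred H x
    not-edge Hx≡false Hx≡true with trans (sym Hx≡true) Hx≡false
    ... | ()
    covered : ∀ y → asPred H y ⊎ y ∈ₗ nonedges H
    covered y with H y in Hy
    ... | true = inj₁ refl
    ... | false = inj₂ (∈-nonedges⁺ Hy)

module _ {d n : ℕ} {p : Fin d → ℕ} where

  G0-nonedge : ∀ {x} → G0 n p x ≡ false → ∀ i → p i ≤ orderStat x i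
  G0-nonedge {x} = from-does (all? (λ i → p i ≤? orderStat x i))
    where
    from-does : ∀ {A : Set} (A? : Dec A) → not (does A?) ≡ false → A
    from-does (yes a) _ = a
    from-does (no _) ()

  G0-nonedge-closesCopy : (∀ i → 1 ≤ p i) → ∀ {x} → G0 n p x ≡ false → ClosesCopy p x
  G0-nonedge-closesCopy p≥1 {x} x∉G0 G below with sortVec-reorders (labels x)
  ... | τ , sort∘τ = τ , S , ∣S∣ , x∈S , S-inside
    where
    q : Fin d → ℕ
    q j = p (τ ⟨$⟩ʳ j)

    q≤x : ∀ j → q j ≤ suc (toℕ (lookup x j))
    q≤x j = subst (q j ≤_) (trans (sort∘τ j) (lookup-map j _ x)) (G0-nonedge {x} x∉G0 (τ ⟨$⟩ʳ j))

    S : Fin d → Subset n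
    S j = segment (pred (q j)) (lookup x j)

    ∣S∣ : ∀ j → ∣ S j ∣ ≡ q j
    ∣S∣ j = trans (∣segment∣ (pred (q j)) (lookup x j) (pred-mono-≤ (q≤x j)))
                  (suc-pred (q j) {{>-nonZero (p≥1 _)}})

    x∈S : ∀ j → lookup x j ∈ˢ S j
    x∈S j = x∈segment (pred (q j)) (lookup x j)

    S-inside : ∀ y → (∀ j → lookup y j ∈ˢ S j) → addEdge G x y
    S-inside y y∈S with ≡-dec Fin._≟_ y x
    ... | yes y≡x = inj₂ y≡x
    ... | no y≢x = inj₁ (below y (λ j → ∈segment⇒≤ (pred (q j)) (lookup x j) (y∈S j)) y≢x)

lemma1 : (d n : ℕ) (p : Fin d → ℕ)
    → (∀ i → 1 ≤ p i) → (∀ i → p i ≤ n) → (∀ i j → i ≤ᶠ j → p i ≤ p j)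
    → W≤ d n p (edgeCount (G0 n p))
lemma1 d n p p≥1 _ _ = G0 n p , weaklySaturated p (G0 n p) (G0-nonedge-closesCopy p≥1) , ≤-refl
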